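{- Let $G$ be a finite simple graph whose vertex set is partitioned into $V_1,V_2$, with $G_1=G[V_1]$ and $G_2=G[V_2]$, and suppose $G$ admits a canonical interval $2$-join $((X_1,Y_1),(X_2,Y_2))$ between $G_1$ and $G_2$. Then $G$ is not vertex-critical for Property $(\star)$.
   Context: A generalized $2$-join $((X_1,Y_1),(X_2,Y_2))$ of $G$ with respect to the partition $V_1,V_2$ consists of cliques $X_i,Y_i\subseteq V_i$ ($i=1,2$) such that $X_1\cup X_2$ and $Y_1\cup Y_2$ are cliques and there are no other edges between $V_1$ and $V_2$. A linear interval graph is a graph whose vertices are finitely many distinct points on a line $L$, with a set of intervals of $L$, two vertices adjacent iff both lie in a common interval. A linear interval strip $(G_2,A,B)$ is a linear interval graph $G_2$ together with cliques $A$, $B$ consisting of the $|A|$ leftmost and the $|B|$ rightmost vertices in some linear interval representation of $G_2$. The generalized $2$-join is a canonical interval $2$-join if $(G_2,X_2,Y_2)$ is a linear interval strip with $X_2\cap Y_2=\emptyset$ and $G_2$ is not a clique. Property $(\star)$ for a graph $G$ means $\chi(G)>\Delta_2(G)+3$, where $\Delta_2(G)$ is the maximum over distinct vertices of the number of common neighbors; $G$ is vertex-critical for Property $(\star)$ if it satisfies it but no proper induced subgraph does. -}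

module Defs where

open import Data.Bool using (Bool; true; false; _∧_)
open import Data.Nat using (ℕ; zero; suc; _+_; _<_; _≤_; _⊔_)
open import Data.Fin using (Fin; toℕ; _≟_)
open import Data.Fin.Subset using (Subset; _∈_; _∉_; _⊆_; ∁; ∣_∣)
open import Data.Vec using (tabulate)
open import Data.List using (List; foldr; map; allFin)
open import Data.List.Membership.Propositional using () renaming (_∈_ to _∈ˡ_)
open import Data.Product using (Σ; ∃; _×_; _,_)
open import Data.Sum using (_⊎_)
open import Data.Empty using (⊥)
open import Relation.Nullary using (¬_; does)
open import Relation.Binary.PropositionalEquality using (_≡_; _≢_)
open import Function.Definitions using (Injective)
open import Function.Bundles using (_⇔_)

record Graph (n : ℕ) : Set where
  field
    adj   : Fin n → Fin n → Bool
    sym   : ∀ u v → adj u v ≡ adj v u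
    irrefl : ∀ u → adj u u ≡ false

open Graph public

Adjacent : ∀ {n} → Graph n → Fin n → Fin n → Set
Adjacent G u v = adj G u v ≡ true

IsClique : ∀ {n} → Graph n → Subset n → Set
IsClique G S = ∀ u v → u ∈ S → v ∈ S → u ≢ v → Adjacent G u v

ProperColouring : ∀ {n k} → Graph n → (Fin n → Fin k) → Set
ProperColouring G c = ∀ u v → Adjacent G u v → c u ≢ c v

χ>_ : ∀ {n} → ℕ → Graph n → Set
(χ> k) G = ¬ (Σ (Fin _ → Fin k) λ c → ProperColouring G c)

-- Δ₂(G): maximum over pairs of distinct vertices of the number of common
-- neighbours (0 if there is no such pair).

commonNeighbours : ∀ {n} → Graph n → Fin n → Fin n → ℕ
commonNeighbours G u v = ∣ tabulate (λ w → adj G u w ∧ adj G v w) ∣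

maxList : List ℕ → ℕ
maxList = foldr _⊔_ 0

Δ₂ : ∀ {n} → Graph n → ℕ
Δ₂ {n} G = maxList (map (λ u → maxList (map (λ v → pairVal u v) (allFin n))) (allFin n))
  where
  pairVal : Fin n → Fin n → ℕ
  pairVal u v with does (u ≟ v)
  ... | true  = 0
  ... | false = commonNeighbours G u v

Star : ∀ {n} → Graph n → Set
Star G = (χ> (Δ₂ G + 3)) G

-- Induced subgraph of G along an injection f : Fin m → Fin n
-- (i.e. G[image f], up to relabelling).
induced : ∀ {m n} → Graph n → (Fin m → Fin n) → Graph m
induced G f = record
  { adj = λ u v → adj G (f u) (f v)
  ; sym = λ u v → sym G (f u) (f v)
  ; irrefl = λ u → irrefl G (f u)
  }

-- Vertex-critical for (⋆): G satisfies (⋆) but no proper induced subgraph does.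
-- Proper induced subgraphs = induced subgraphs on the image of an injection
-- Fin m → Fin n with m < n.
VertexCriticalStar : ∀ {n} → Graph n → Set
VertexCriticalStar {n} G =
  Star G ×
  (∀ m (f : Fin m → Fin n) → Injective _≡_ _≡_ f → m < n → ¬ Star (induced G f))

-- Generalized 2-join with respect to the partition V₁ = ∁ V₂, V₂.

record Generalized2Join {n} (G : Graph n) (V₂ X₁ Y₁ X₂ Y₂ : Subset n) : Set where
  field
    X₁⊆V₁ : X₁ ⊆ ∁ V₂
    Y₁⊆V₁ : Y₁ ⊆ ∁ V₂
    X₂⊆V₂ : X₂ ⊆ V₂
    Y₂⊆V₂ : Y₂ ⊆ V₂
    X₁-clique : IsClique G X₁
    Y₁-clique : IsClique G Y₁
    X₂-clique : IsClique G X₂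
    Y₂-clique : IsClique G Y₂
    -- X₁ ∪ X₂ and Y₁ ∪ Y₂ are cliques (given the above, this is the
    -- complete adjacency across the partition)
    X₁X₂-complete : ∀ u v → u ∈ X₁ → v ∈ X₂ → Adjacent G u v
    Y₁Y₂-complete : ∀ u v → u ∈ Y₁ → v ∈ Y₂ → Adjacent G u v
    no-other-edges : ∀ u v → u ∉ V₂ → v ∈ V₂ → Adjacent G u v →
                     (u ∈ X₁ × v ∈ X₂) ⊎ (u ∈ Y₁ × v ∈ Y₂)

-- A linear interval representation of G[V₂] with m = |V₂| points: the points
-- on the line are listed left to right by a bijection pos : Fin m → V₂, and
-- the intervals (restricted to the points) are contiguous ranges [a, b] of
-- positions.

InInterval : ∀ {m} → Fin m × Fin m → Fin m → Set
InInterval (a , b) i = toℕ a ≤ toℕ i × toℕ i ≤ toℕ b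

record LinearIntervalStrip {n} (G : Graph n) (V₂ A B : Subset n) : Set where
  field
    m         : ℕ
    pos       : Fin m → Fin n
    pos-inj   : Injective _≡_ _≡_ pos
    pos-in    : ∀ i → pos i ∈ V₂
    pos-onto  : ∀ v → v ∈ V₂ → ∃ λ i → pos i ≡ v
    intervals : List (Fin m × Fin m)
    represents : ∀ i j → i ≢ j →
                 Adjacent G (pos i) (pos j) ⇔
                 (∃ λ I → I ∈ˡ intervals × InInterval I i × InInterval I j)
    A⊆V₂ : A ⊆ V₂
    B⊆V₂ : B ⊆ V₂
    A-clique : IsClique G A
    B-clique : IsClique G B
    A-leftmost  : ∀ i → pos i ∈ A ⇔ toℕ i < ∣ A ∣
    B-rightmost : ∀ i → pos i ∈ B ⇔ m ≤ toℕ i + ∣ B ∣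

record CanonicalInterval2Join {n} (G : Graph n) (V₂ X₁ Y₁ X₂ Y₂ : Subset n) : Set where
  field
    gen2join : Generalized2Join G V₂ X₁ Y₁ X₂ Y₂
    strip    : LinearIntervalStrip G V₂ X₂ Y₂
    X₂Y₂-disjoint : ∀ v → v ∈ X₂ → v ∈ Y₂ → ⊥
    G₂-not-clique : ∃ λ u → ∃ λ v → u ∈ V₂ × v ∈ V₂ × u ≢ v × ¬ Adjacent G u v

{-# OPTIONS --safe #-}
-- Let k = Δ₂(G) + 3. If, for some u ≠ v, every coloured neighbour of v is u, one further
-- vertex b, or a common neighbour of u and v, then these neighbours use at most Δ₂(G) + 2
-- colours and a proper k-colouring extends to v. By criticality G − x is k-colourable for every
-- vertex x (Δ₂ does not grow on induced subgraphs), so it suffices to find one x from which such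
-- extensions reach a k-colouring of G.
-- Order V₂ as p₀ < … < p_{m−1} along the line; m ≥ 2 as G₂ is not a clique.
-- If |Y₂| ≥ 2, then p_{m−2}, p_{m−1} ∈ Y₂ and every neighbour of x = p_{m−1} other than p_{m−2}
-- is adjacent to p_{m−2}: inside V₂ by the interval property, outside V₂ because it lies in Y₁
-- (p_{m−1} ∉ X₂).
-- If |Y₂| ≤ 1, colour G − p_{m−2}, keep only the colours on V₁ ∪ {p_{m−1}}, and add p₀, …, p_{m−2}
-- in this order with b = p_{m−1}. Since p_t ∉ Y₂, its neighbours in V₁ lie in X₁ and then
-- p_t ∈ X₂; take u to be an earlier neighbour of p_t (it lies in X₂ too, hence is complete to
-- those neighbours), failing that a neighbour in X₁, failing that p_{m−1}.

module Submission where

open import Defs hiding (sym)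
open import Data.Bool using (Bool; true; false; _∧_)
import Data.Bool as Bool
open import Data.Nat using (ℕ; zero; suc; _+_; _≤_; _<_; _≤?_; _<?_; z≤n; s≤s; s≤s⁻¹; z<s)
open import Data.Nat.Properties
  using (≤-refl; ≤-reflexive; ≤-trans; <-trans; ≤-<-trans; <⇒≤; <⇒≱; <-irrefl; ≰⇒>; n<1+n; m<m+n;
         m≤n⇒m<n∨m≡n; m<1+n⇒m<n∨m≡n;
         m≤m⊔n; m≤n⊔m; ⊔-lub; +-comm; +-suc; +-monoʳ-≤; +-monoˡ-≤; +-monoʳ-<; module ≤-Reasoning)
open import Data.Fin as Fin using (Fin; zero; suc; toℕ; fromℕ; fromℕ<; inject₁; inject≤; punchIn; punchOut; _≟_)
open import Data.Fin.Properties
  using (any?; ≤-total; <⇒≢; toℕ<n; toℕ-injective; toℕ-fromℕ; toℕ-fromℕ<; toℕ-inject₁; suc-injective; injective⇒≤;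
         punchIn-injective; punchIn-punchOut; inject≤-injective)
open import Data.Fin.Subset using (Subset; _∈_; _∉_; ∣_∣; inside; outside; _∪_; ⁅_⁆)
open import Data.Fin.Subset.Properties using (_∈?_; ∣p∣≤∣x∷p∣; x∈p∪q⁺; x∈⁅x⁆; ∣⁅x⁆∣≡1)
open import Data.List using ([]; _∷_; map; allFin)
open import Data.List.Membership.Propositional using () renaming (_∈_ to _∈ˡ_)
open import Data.List.Membership.Propositional.Properties using (∈-map⁺; ∈-map⁻; ∈-allFin)
open import Data.List.Relation.Unary.Any as Any using ()
open import Data.Product using (∃; ∃₂; _×_; _,_; proj₁; proj₂; map₂)
open import Data.Sum using (_⊎_; inj₁; inj₂; swap)
open import Data.Unit using (⊤; tt)
open import Data.Vec using (_∷_; []; tabulate)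
open import Data.Vec.Base using (here; there)
open import Data.Vec.Properties using (lookup⇒[]=; lookup∘tabulate)
open import Data.Vec.Functional using (updateAt)
open import Data.Vec.Functional.Properties using (updateAt-updates; updateAt-minimal)
open import Function using (id; _∘_; const; case_of_)
open import Function.Bundles using (Equivalence)
open import Function.Definitions using (Injective)
open import Relation.Binary.PropositionalEquality using (_≡_; _≢_; refl; sym; trans; cong; cong₂; subst; subst₂; ≢-sym)
open import Relation.Nullary using (¬_; Dec; yes; no; contradiction)
open import Relation.Nullary.Decidable using (¬?; _×-dec_; decidable-stable; toSum)

∈⇒≤maxList : ∀ {x} xs → x ∈ˡ xs → x ≤ maxList xs
∈⇒≤maxList (y ∷ ys) (Any.here refl) = m≤m⊔n y (maxList ys)
∈⇒≤maxList (y ∷ ys) (Any.there x∈ys) = ≤-trans (∈⇒≤maxList ys x∈ys) (m≤n⊔m y (maxList ys))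

maxList-least : ∀ {b} xs → (∀ {x} → x ∈ˡ xs → x ≤ b) → maxList xs ≤ b
maxList-least []       _      = z≤n
maxList-least (y ∷ ys) bounds = ⊔-lub (bounds (Any.here refl)) (maxList-least ys (bounds ∘ Any.there))

maxOver : ∀ {n} → (Fin n → ℕ) → ℕ
maxOver {n} f = maxList (map f (allFin n))

≤maxOver : ∀ {n} (f : Fin n → ℕ) i → f i ≤ maxOver f
≤maxOver f i = ∈⇒≤maxList _ (∈-map⁺ f (∈-allFin i))

maxOver-least : ∀ {n b} (f : Fin n → ℕ) → (∀ i → f i ≤ b) → maxOver f ≤ b
maxOver-least f bounds = maxList-least (map f (allFin _)) λ x∈ → case ∈-map⁻ f x∈ of λ where
  (i , _ , refl) → bounds i

rank : ∀ {n} (p : Subset n) {x} → x ∈ p → Fin ∣ p ∣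
rank (inside  ∷ p) here         = zero
rank (inside  ∷ p) (there x∈p) = suc (rank p x∈p)
rank (outside ∷ p) (there x∈p) = rank p x∈p

rank-injective : ∀ {n} (p : Subset n) {x y} (x∈p : x ∈ p) (y∈p : y ∈ p) → rank p x∈p ≡ rank p y∈p → x ≡ y
rank-injective (inside  ∷ p) here         here         _  = refl
rank-injective (inside  ∷ p) (there x∈p) (there y∈p) eq = cong suc (rank-injective p x∈p y∈p (suc-injective eq))
rank-injective (outside ∷ p) (there x∈p) (there y∈p) eq = cong suc (rank-injective p x∈p y∈p eq)

injective⇒≤∣p∣ : ∀ {m n} (p : Subset n) (f : Fin m → Fin n) → Injective _≡_ _≡_ f → (∀ i → f i ∈ p) → m ≤ ∣ p ∣
injective⇒≤∣p∣ p f f-injective f∈p =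
  injective⇒≤ {f = λ i → rank p (f∈p i)} λ eq → f-injective (rank-injective p (f∈p _) (f∈p _) eq)

∣p∪q∣≤∣p∣+∣q∣ : ∀ {n} (p q : Subset n) → ∣ p ∪ q ∣ ≤ ∣ p ∣ + ∣ q ∣
∣p∪q∣≤∣p∣+∣q∣ []            []            = z≤n
∣p∪q∣≤∣p∣+∣q∣ (inside  ∷ p) (s ∷ q)       = s≤s (≤-trans (∣p∪q∣≤∣p∣+∣q∣ p q) (+-monoʳ-≤ ∣ p ∣ (∣p∣≤∣x∷p∣ s q)))
∣p∪q∣≤∣p∣+∣q∣ (outside ∷ p) (inside  ∷ q) = ≤-trans (s≤s (∣p∪q∣≤∣p∣+∣q∣ p q)) (≤-reflexive (sym (+-suc ∣ p ∣ ∣ q ∣)))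
∣p∪q∣≤∣p∣+∣q∣ (outside ∷ p) (outside ∷ q) = ∣p∪q∣≤∣p∣+∣q∣ p q

∣tabulate∘punchIn∣≤∣tabulate∣ : ∀ {n} (x : Fin (suc n)) (g : Fin (suc n) → Bool) →
                                ∣ tabulate (g ∘ punchIn x) ∣ ≤ ∣ tabulate g ∣
∣tabulate∘punchIn∣≤∣tabulate∣ zero g = ∣p∣≤∣x∷p∣ (g zero) (tabulate (g ∘ suc))
∣tabulate∘punchIn∣≤∣tabulate∣ {suc n} (suc x) g with g zero
... | true  = s≤s (∣tabulate∘punchIn∣≤∣tabulate∣ x (g ∘ suc))
... | false = ∣tabulate∘punchIn∣≤∣tabulate∣ x (g ∘ suc)

adjacent-sym : ∀ {n} (G : Graph n) {u v} → Adjacent G u v → Adjacent G v u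
adjacent-sym G {u} {v} = trans (Graph.sym G v u)

adjacent-irrefl : ∀ {n} (G : Graph n) {v} → ¬ Adjacent G v v
adjacent-irrefl G {v} adj-vv with trans (sym adj-vv) (irrefl G v)
... | ()

commonNeighbourhood : ∀ {n} → Graph n → Fin n → Fin n → Subset n
commonNeighbourhood G u v = tabulate λ w → adj G u w ∧ adj G v w

∈-commonNeighbourhood : ∀ {n} (G : Graph n) {u v w} → Adjacent G u w → Adjacent G v w → w ∈ commonNeighbourhood G u v
∈-commonNeighbourhood G {u} {v} {w} adj-uw adj-vw =
  lookup⇒[]= w _ (trans (lookup∘tabulate _ w) (cong₂ _∧_ adj-uw adj-vw))

adjacent? : ∀ {n} (G : Graph n) u v → Dec (Adjacent G u v)
adjacent? G u v = adj G u v Bool.≟ true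

-- The pair function in the definition of Δ₂ is local to it; unification against Δ₂ G names it.
Δ₂-pairValue : ∀ {n} (G : Graph n) → ∃ λ (value : Fin n → Fin n → ℕ) → maxOver (λ u → maxOver (value u)) ≡ Δ₂ G
Δ₂-pairValue G = _ , refl

pairValue-distinct : ∀ {n} (G : Graph n) u v → u ≢ v → proj₁ (Δ₂-pairValue G) u v ≡ commonNeighbours G u v
pairValue-distinct G u v u≢v with u ≟ v
... | yes u≡v = contradiction u≡v u≢v
... | no _    = refl

pairValue-bounded : ∀ {n b} (G : Graph n) → (∀ u v → u ≢ v → commonNeighbours G u v ≤ b) →
                    ∀ u v → proj₁ (Δ₂-pairValue G) u v ≤ b
pairValue-bounded G bounds u v with u ≟ v
... | yes _   = z≤n
... | no u≢v = bounds u v u≢v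

commonNeighbours≤Δ₂ : ∀ {n} (G : Graph n) u v → u ≢ v → commonNeighbours G u v ≤ Δ₂ G
commonNeighbours≤Δ₂ G u v u≢v =
  subst (_≤ Δ₂ G) (pairValue-distinct G u v u≢v) (≤-trans (≤maxOver (value u) v) (≤maxOver (maxOver ∘ value) u))
  where value = proj₁ (Δ₂-pairValue G)

Δ₂-least : ∀ {n b} (G : Graph n) → (∀ u v → u ≢ v → commonNeighbours G u v ≤ b) → Δ₂ G ≤ b
Δ₂-least G bounds = maxOver-least _ λ u → maxOver-least _ (pairValue-bounded G bounds u)

Δ₂-punchIn≤Δ₂ : ∀ {n} (G : Graph (suc n)) (x : Fin (suc n)) → Δ₂ (induced G (punchIn x)) ≤ Δ₂ G
Δ₂-punchIn≤Δ₂ G x = Δ₂-least (induced G (punchIn x)) λ u v u≢v →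
  ≤-trans (∣tabulate∘punchIn∣≤∣tabulate∣ x λ w → adj G (punchIn x u) w ∧ adj G (punchIn x v) w)
          (commonNeighbours≤Δ₂ G (punchIn x u) (punchIn x v) (u≢v ∘ punchIn-injective x u v))

ProperOn : ∀ {n k} → Graph n → (Fin n → Set) → (Fin n → Fin k) → Set
ProperOn G D c = ∀ u v → D u → D v → Adjacent G u v → c u ≢ c v

ColourableOn : ∀ {n} → ℕ → Graph n → (Fin n → Set) → Set
ColourableOn {n} k G D = ∃ λ (c : Fin n → Fin k) → ProperOn G D c

colourableOn-mono : ∀ {n k} (G : Graph n) {D D′ : Fin n → Set} →
                    (∀ {w} → D′ w → D w) → ColourableOn k G D → ColourableOn k G D′
colourableOn-mono G D′⊆D (c , proper) = c , λ u v D′u D′v → proper u v (D′⊆D D′u) (D′⊆D D′v)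

colourableOn-everywhere : ∀ {n k} (G : Graph n) {D : Fin n → Set} →
                          (∀ w → D w) → ColourableOn k G D → ∃ λ (c : Fin n → Fin k) → ProperColouring G c
colourableOn-everywhere G all-D (c , proper) = c , λ u v → proper u v (all-D u) (all-D v)

allColoursUsed⇒≤∣p∣ : ∀ {n k} (c : Fin n → Fin k) (p : Subset n) → (∀ α → ∃ λ w → w ∈ p × c w ≡ α) → k ≤ ∣ p ∣
allColoursUsed⇒≤∣p∣ c p used = injective⇒≤∣p∣ p witness witness-injective (proj₁ ∘ proj₂ ∘ used)
  where
  witness = proj₁ ∘ used
  witness-injective : Injective _≡_ _≡_ witness
  witness-injective {α} {β} eq = trans (sym (proj₂ (proj₂ (used α)))) (trans (cong c eq) (proj₂ (proj₂ (used β))))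

freeColour : ∀ {n k} (c : Fin n → Fin k) (p : Subset n) → ∣ p ∣ < k → ∃ λ α → ∀ {w} → w ∈ p → c w ≢ α
freeColour c p ∣p∣<k =
  map₂ (λ unused w∈p cw≡α → unused (_ , w∈p , cw≡α)) (decidable-stable (any? (¬? ∘ used?)) λ ¬free →
    <⇒≱ ∣p∣<k (allColoursUsed⇒≤∣p∣ c p λ α → decidable-stable (used? α) (¬free ∘ (α ,_))))
  where
  used? : ∀ α → Dec (∃ λ w → w ∈ p × c w ≡ α)
  used? α = any? λ w → w ∈? p ×-dec c w ≟ α

module _ {n k} (G : Graph n) {D : Fin n → Set} {c : Fin n → Fin k} {v : Fin n} {α : Fin k} where
  private
    old : ∀ {w} → D w ⊎ v ≡ w → v ≢ w → D w
    old (inj₁ Dw)   _   = Dw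
    old (inj₂ v≡w) v≢w = contradiction v≡w v≢w

  properOn-insert : ProperOn G D c → (∀ {w} → D w → Adjacent G v w → c w ≢ α) →
                    ProperOn G (λ w → D w ⊎ v ≡ w) (updateAt c v (const α))
  properOn-insert proper α-free x y x∈ y∈ adj-xy with v ≟ x | v ≟ y
  ... | yes refl | yes refl = contradiction adj-xy (adjacent-irrefl G)
  ... | yes refl | no v≢y  =
    subst₂ _≢_ (sym (updateAt-updates v c)) (sym (updateAt-minimal y v c (≢-sym v≢y)))
           (≢-sym (α-free (old y∈ v≢y) adj-xy))
  ... | no v≢x  | yes refl =
    subst₂ _≢_ (sym (updateAt-minimal x v c (≢-sym v≢x))) (sym (updateAt-updates v c))
           (α-free (old x∈ v≢x) (adjacent-sym G adj-xy))
  ... | no v≢x  | no v≢y  =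
    subst₂ _≢_ (sym (updateAt-minimal x v c (≢-sym v≢x))) (sym (updateAt-minimal y v c (≢-sym v≢y)))
           (proper x y (old x∈ v≢x) (old y∈ v≢y) adj-xy)

NeighboursCovered : ∀ {n} → Graph n → (Fin n → Set) → (v u b : Fin n) → Set
NeighboursCovered G D v u b = ∀ {w} → D w → Adjacent G v w → Adjacent G u w ⊎ w ≡ u ⊎ w ≡ b

colourableOn-insert : ∀ {n k} (G : Graph n) {D : Fin n → Set} {v u b} →
                      commonNeighbours G v u + 2 < k → NeighboursCovered G D v u b →
                      ColourableOn k G D → ColourableOn k G (λ w → D w ⊎ v ≡ w)
colourableOn-insert {k = k} G {D} {v} {u} {b} few covered (c , proper) =
  updateAt c v (const α) , properOn-insert G proper λ Dw adj-vw → α-free (covered∈S adj-vw (covered Dw adj-vw))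
  where
  N = commonNeighbourhood G v u
  S = N ∪ ⁅ u ⁆ ∪ ⁅ b ⁆

  ∣S∣≤ : ∣ S ∣ ≤ commonNeighbours G v u + 2
  ∣S∣≤ = begin
    ∣ N ∪ ⁅ u ⁆ ∪ ⁅ b ⁆ ∣             ≤⟨ ∣p∪q∣≤∣p∣+∣q∣ N _ ⟩
    ∣ N ∣ + ∣ ⁅ u ⁆ ∪ ⁅ b ⁆ ∣         ≤⟨ +-monoʳ-≤ ∣ N ∣ (∣p∪q∣≤∣p∣+∣q∣ ⁅ u ⁆ ⁅ b ⁆) ⟩
    ∣ N ∣ + (∣ ⁅ u ⁆ ∣ + ∣ ⁅ b ⁆ ∣)   ≡⟨ cong₂ (λ i j → ∣ N ∣ + (i + j)) (∣⁅x⁆∣≡1 u) (∣⁅x⁆∣≡1 b) ⟩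
    ∣ N ∣ + 2                         ∎
    where open ≤-Reasoning

  α : Fin k
  α = proj₁ (freeColour c S (≤-<-trans ∣S∣≤ few))
  α-free : ∀ {w} → w ∈ S → c w ≢ α
  α-free = proj₂ (freeColour c S (≤-<-trans ∣S∣≤ few))

  covered∈S : ∀ {w} → Adjacent G v w → Adjacent G u w ⊎ w ≡ u ⊎ w ≡ b → w ∈ S
  covered∈S adj-vw (inj₁ adj-uw)        = x∈p∪q⁺ (inj₁ (∈-commonNeighbourhood G adj-vw adj-uw))
  covered∈S _      (inj₂ (inj₁ refl)) = x∈p∪q⁺ (inj₂ (x∈p∪q⁺ (inj₁ (x∈⁅x⁆ u))))
  covered∈S _      (inj₂ (inj₂ refl)) = x∈p∪q⁺ (inj₂ (x∈p∪q⁺ (inj₂ (x∈⁅x⁆ b))))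

ReducibleVertex : ∀ {n} → ℕ → Graph n → Fin n → Set
ReducibleVertex k G x = ColourableOn k G (x ≢_) → ColourableOn k G λ _ → ⊤

critical⇒¬¬colourableOn-≢ : ∀ {n} {G : Graph n} →
                            (∀ m (f : Fin m → Fin n) → Injective _≡_ _≡_ f → m < n → ¬ Star (induced G f)) →
                            ∀ x → ¬ ¬ ColourableOn (Δ₂ G + 3) G (x ≢_)
critical⇒¬¬colourableOn-≢ {suc n} {G} critical x ¬colourable =
  critical n (punchIn x) (punchIn-injective x _ _) ≤-refl λ (c , proper) →
    ¬colourable (colour c , colour-proper c proper)
  where
  G-x = induced G (punchIn x)
  fewer = +-monoˡ-≤ 3 (Δ₂-punchIn≤Δ₂ G x)

  colour : (Fin n → Fin (Δ₂ G-x + 3)) → Fin (suc n) → Fin (Δ₂ G + 3)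
  colour c w with x ≟ w
  ... | yes _    = fromℕ< (m<m+n (Δ₂ G) z<s)
  ... | no x≢w = inject≤ (c (punchOut x≢w)) fewer

  colour-proper : ∀ c → ProperColouring G-x c → ProperOn G (x ≢_) (colour c)
  colour-proper c proper u v x≢u x≢v adj-uv with x ≟ u | x ≟ v
  ... | yes x≡u | _        = contradiction x≡u x≢u
  ... | no _    | yes x≡v = contradiction x≡v x≢v
  ... | no x≢u | no x≢v  =
    proper (punchOut x≢u) (punchOut x≢v)
           (subst₂ (Adjacent G) (sym (punchIn-punchOut x≢u)) (sym (punchIn-punchOut x≢v)) adj-uv)
    ∘ inject≤-injective fewer fewer _ _

critical⇒¬reducibleVertex : ∀ {n} {G : Graph n} → VertexCriticalStar G → ¬ ∃ (ReducibleVertex (Δ₂ G + 3) G)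
critical⇒¬reducibleVertex {G = G} (star , critical) (x , reducible) =
  critical⇒¬¬colourableOn-≢ critical x λ colourable →
    star (colourableOn-everywhere G (λ _ → tt) (reducible colourable))

module _ {n} {G : Graph n} {V₂ A B : Subset n} (strip : LinearIntervalStrip G V₂ A B) where
  open LinearIntervalStrip strip

  adjacent-within : ∀ {i l a b : Fin m} → Adjacent G (pos i) (pos l) →
                    i Fin.≤ a → a Fin.≤ l → i Fin.≤ b → b Fin.≤ l → a ≢ b → Adjacent G (pos a) (pos b)
  adjacent-within {i} {l} {a} {b} adj-il i≤a a≤l i≤b b≤l a≢b
    with Equivalence.to (represents i l λ { refl → adjacent-irrefl G adj-il }) adj-il
  ... | I , I∈ , (s≤i , _) , (_ , l≤e) =
    Equivalence.from (represents a b a≢b)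
      (I , I∈ , (≤-trans s≤i i≤a , ≤-trans a≤l l≤e) , (≤-trans s≤i i≤b , ≤-trans b≤l l≤e))

  leftNeighbours-adjacent : ∀ {p j j′ : Fin m} → j Fin.≤ p → j′ Fin.≤ p →
                            Adjacent G (pos p) (pos j) → Adjacent G (pos p) (pos j′) → j ≢ j′ →
                            Adjacent G (pos j) (pos j′)
  leftNeighbours-adjacent {j = j} {j′} j≤p j′≤p adj-pj adj-pj′ j≢j′ with ≤-total j j′
  ... | inj₁ j≤j′ = adjacent-within (adjacent-sym G adj-pj) ≤-refl j≤p j≤j′ j′≤p j≢j′
  ... | inj₂ j′≤j = adjacent-sym G (adjacent-within (adjacent-sym G adj-pj′) ≤-refl j′≤p j′≤j j≤p (≢-sym j≢j′))

lastTwo : ∀ {m} {i j : Fin m} → i ≢ j → ∃₂ λ (p l : Fin m) → suc (toℕ p) ≡ toℕ l × suc (toℕ l) ≡ m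
lastTwo {suc zero}    {zero} {zero} i≢j = contradiction refl i≢j
lastTwo {suc (suc m)} _ =
  inject₁ (fromℕ m) , fromℕ (suc m) , cong suc (toℕ-inject₁ (fromℕ m)) , cong suc (toℕ-fromℕ (suc m))

module _ {n} {G : Graph n} {V₂ X₁ Y₁ X₂ Y₂ : Subset n} (cj : CanonicalInterval2Join G V₂ X₁ Y₁ X₂ Y₂)
         {k} (k-large : Δ₂ G + 2 < k) where
  open CanonicalInterval2Join cj
  open Generalized2Join gen2join
  open LinearIntervalStrip strip

  private
    insert : ∀ {D v u b} → v ≢ u → NeighboursCovered G D v u b →
             ColourableOn k G D → ColourableOn k G (λ w → D w ⊎ v ≡ w)
    insert {v = v} {u} v≢u = colourableOn-insert G (≤-<-trans (+-monoˡ-≤ 2 (commonNeighbours≤Δ₂ G v u v≢u)) k-large)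

    distinctPositions : ∃₂ λ (i j : Fin m) → i ≢ j
    distinctPositions with G₂-not-clique
    ... | u , v , u∈V₂ , v∈V₂ , u≢v , _ with pos-onto u u∈V₂ | pos-onto v v∈V₂
    ... | i , refl | j , refl = i , j , u≢v ∘ cong pos

    crossingEdge : ∀ i {w} → pos i ∉ Y₂ → w ∉ V₂ → Adjacent G (pos i) w → w ∈ X₁ × pos i ∈ X₂
    crossingEdge i i∉Y₂ w∉V₂ adj-iw with no-other-edges _ _ w∉V₂ (pos-in i) (adjacent-sym G adj-iw)
    ... | inj₁ X₁X₂-edge  = X₁X₂-edge
    ... | inj₂ (_ , i∈Y₂) = contradiction i∈Y₂ i∉Y₂

    X₂-leftClosed : ∀ {i j} → j Fin.< i → pos i ∈ X₂ → pos j ∈ X₂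
    X₂-leftClosed {i} {j} j<i i∈X₂ =
      Equivalence.from (A-leftmost j) (<-trans j<i (Equivalence.to (A-leftmost i) i∈X₂))

  module Ends (pen last : Fin m) (pen+1≡last : suc (toℕ pen) ≡ toℕ last) (last+1≡m : suc (toℕ last) ≡ m) where

    ≤last : ∀ j → j Fin.≤ last
    ≤last j = s≤s⁻¹ (subst (toℕ j <_) (sym last+1≡m) (toℕ<n j))

    pen≢last : pen ≢ last
    pen≢last = <⇒≢ (≤-reflexive pen+1≡last)

    lastReducible : 2 ≤ ∣ Y₂ ∣ → ReducibleVertex k G (pos last)
    lastReducible 2≤∣Y₂∣ colourable =
      colourableOn-mono G (λ {w} _ → swap (toSum (q ≟ w))) (insert (pen≢last ∘ pos-inj ∘ sym) covered colourable)
      where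
      q = pos last
      u = pos pen

      q∈Y₂ : q ∈ Y₂
      q∈Y₂ = Equivalence.from (B-rightmost last) (begin
        m                    ≡⟨ sym last+1≡m ⟩
        suc (toℕ last)       ≤⟨ m<m+n (toℕ last) (≤-trans (s≤s z≤n) 2≤∣Y₂∣) ⟩
        toℕ last + ∣ Y₂ ∣    ∎)
        where open ≤-Reasoning

      u∈Y₂ : u ∈ Y₂
      u∈Y₂ = Equivalence.from (B-rightmost pen) (begin
        m                    ≡⟨ sym last+1≡m ⟩
        suc (toℕ last)       ≡⟨ cong suc (sym pen+1≡last) ⟩
        2 + toℕ pen          ≡⟨ +-comm 2 (toℕ pen) ⟩
        toℕ pen + 2          ≤⟨ +-monoʳ-≤ (toℕ pen) 2≤∣Y₂∣ ⟩
        toℕ pen + ∣ Y₂ ∣     ∎)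
        where open ≤-Reasoning

      covered : NeighboursCovered G (q ≢_) q u u
      covered {w} q≢w adj-qw with w ∈? V₂
      ... | no w∉V₂ with no-other-edges w q w∉V₂ (pos-in last) (adjacent-sym G adj-qw)
      ...   | inj₁ (_ , q∈X₂)   = contradiction q∈Y₂ (X₂Y₂-disjoint q q∈X₂)
      ...   | inj₂ (w∈Y₁ , _)   = inj₁ (adjacent-sym G (Y₁Y₂-complete w u w∈Y₁ u∈Y₂))
      covered q≢w adj-qw | yes w∈V₂ with pos-onto _ w∈V₂
      ... | j , refl with j ≟ pen
      ...   | yes refl  = inj₂ (inj₁ refl)
      ...   | no j≢pen = inj₁ (leftNeighbours-adjacent strip (≤last pen) (≤last j)
                                 (Y₂-clique q u q∈Y₂ u∈Y₂ (pen≢last ∘ pos-inj ∘ sym)) adj-qw (≢-sym j≢pen))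

    module _ (∣Y₂∣≤1 : ∣ Y₂ ∣ ≤ 1) where

      Placed : ℕ → Fin n → Set
      Placed t w = w ∉ V₂ ⊎ w ≡ pos last ⊎ ∃ λ j → toℕ j < t × pos j ≡ w

      ∉Y₂ : ∀ i → i Fin.< last → pos i ∉ Y₂
      ∉Y₂ i i<last i∈Y₂ = <-irrefl refl (begin-strict
        m                    ≤⟨ Equivalence.to (B-rightmost i) i∈Y₂ ⟩
        toℕ i + ∣ Y₂ ∣       ≤⟨ +-monoʳ-≤ (toℕ i) ∣Y₂∣≤1 ⟩
        toℕ i + 1            ≡⟨ +-comm (toℕ i) 1 ⟩
        suc (toℕ i)          ≤⟨ i<last ⟩
        toℕ last             <⟨ n<1+n (toℕ last) ⟩
        suc (toℕ last)       ≡⟨ last+1≡m ⟩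
        m                    ∎)
        where open ≤-Reasoning

      placed-cover : ∀ i → i Fin.< last →
                     ∃ λ u → pos i ≢ u × NeighboursCovered G (Placed (toℕ i)) (pos i) u (pos last)
      placed-cover i i<last with any? (λ j → toℕ j <? toℕ i ×-dec adjacent? G (pos i) (pos j))
      ... | yes (j₁ , j₁<i , adj-ij₁) = pos j₁ , <⇒≢ j₁<i ∘ pos-inj ∘ sym , covered
        where
        covered : NeighboursCovered G (Placed (toℕ i)) (pos i) (pos j₁) (pos last)
        covered (inj₁ w∉V₂) adj-iw with crossingEdge i (∉Y₂ i i<last) w∉V₂ adj-iw
        ... | w∈X₁ , i∈X₂ = inj₁ (adjacent-sym G (X₁X₂-complete _ _ w∈X₁ (X₂-leftClosed j₁<i i∈X₂)))
        covered (inj₂ (inj₁ w≡q)) _ = inj₂ (inj₂ w≡q)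
        covered (inj₂ (inj₂ (j , j<i , refl))) adj-ij with j ≟ j₁
        ... | yes refl = inj₂ (inj₁ refl)
        ... | no j≢j₁ = inj₁ (leftNeighbours-adjacent strip (<⇒≤ j₁<i) (<⇒≤ j<i) adj-ij₁ adj-ij (≢-sym j≢j₁))
      ... | no noLeftNeighbour with any? (λ x → ¬? (x ∈? V₂) ×-dec adjacent? G (pos i) x)
      ...   | yes (x , x∉V₂ , adj-ix) = x , (λ i≡x → x∉V₂ (subst (_∈ V₂) i≡x (pos-in i))) , covered
        where
        covered : NeighboursCovered G (Placed (toℕ i)) (pos i) x (pos last)
        covered {w} (inj₁ w∉V₂) adj-iw with w ≟ x
        ... | yes w≡x = inj₂ (inj₁ w≡x)
        ... | no w≢x = inj₁ (X₁-clique x w (proj₁ (crossingEdge i (∉Y₂ i i<last) x∉V₂ adj-ix))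
                                           (proj₁ (crossingEdge i (∉Y₂ i i<last) w∉V₂ adj-iw)) (≢-sym w≢x))
        covered (inj₂ (inj₁ w≡q)) _ = inj₂ (inj₂ w≡q)
        covered (inj₂ (inj₂ (j , j<i , refl))) adj-ij = contradiction (j , j<i , adj-ij) noLeftNeighbour
      ...   | no noCrossingEdge = pos last , <⇒≢ i<last ∘ pos-inj , covered
        where
        covered : NeighboursCovered G (Placed (toℕ i)) (pos i) (pos last) (pos last)
        covered {w} (inj₁ w∉V₂) adj-iw = contradiction (w , w∉V₂ , adj-iw) noCrossingEdge
        covered (inj₂ (inj₁ w≡q)) _ = inj₂ (inj₁ w≡q)
        covered (inj₂ (inj₂ (j , j<i , refl))) adj-ij = contradiction (j , j<i , adj-ij) noLeftNeighbour

      placed-initial : ∀ {w} → Placed 0 w → pos pen ≢ w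
      placed-initial (inj₁ w∉V₂)       pen≡w = w∉V₂ (subst (_∈ V₂) pen≡w (pos-in pen))
      placed-initial (inj₂ (inj₁ w≡q)) pen≡w = pen≢last (pos-inj (trans pen≡w w≡q))

      placed-all : ∀ w → Placed (toℕ last) w
      placed-all w with w ∈? V₂
      ... | no w∉V₂ = inj₁ w∉V₂
      ... | yes w∈V₂ with pos-onto w w∈V₂
      ...   | j , refl with m≤n⇒m<n∨m≡n (≤last j)
      ...     | inj₁ j<last = inj₂ (inj₂ (j , j<last , refl))
      ...     | inj₂ j≡last = inj₂ (inj₁ (cong pos (toℕ-injective j≡last)))

      placed-suc : ∀ i {w} → Placed (suc (toℕ i)) w → Placed (toℕ i) w ⊎ pos i ≡ w
      placed-suc i (inj₁ w∉V₂)                   = inj₁ (inj₁ w∉V₂)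
      placed-suc i (inj₂ (inj₁ w≡q))             = inj₁ (inj₂ (inj₁ w≡q))
      placed-suc i (inj₂ (inj₂ (j , j≤i , refl))) with m<1+n⇒m<n∨m≡n j≤i
      ... | inj₁ j<i = inj₁ (inj₂ (inj₂ (j , j<i , refl)))
      ... | inj₂ j≡i = inj₂ (cong pos (sym (toℕ-injective j≡i)))

      placed-suc-colourable : ∀ t → t < toℕ last → ColourableOn k G (Placed t) → ColourableOn k G (Placed (suc t))
      placed-suc-colourable t t<last with fromℕ< (<-trans t<last (≤-reflexive last+1≡m))
                                       | toℕ-fromℕ< (<-trans t<last (≤-reflexive last+1≡m))
      ... | i | refl with placed-cover i t<last
      ...   | u , i≢u , covered = colourableOn-mono G (placed-suc i) ∘ insert i≢u covered

      placed-colourable : ∀ t → t ≤ toℕ last → ColourableOn k G (Placed 0) → ColourableOn k G (Placed t)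
      placed-colourable zero    _      = id
      placed-colourable (suc t) t<last = placed-suc-colourable t t<last ∘ placed-colourable t (<⇒≤ t<last)

      penultimateReducible : ReducibleVertex k G (pos pen)
      penultimateReducible =
        colourableOn-mono G (λ {w} _ → placed-all w)
        ∘ placed-colourable (toℕ last) ≤-refl
        ∘ colourableOn-mono G placed-initial

  canonicalInterval2Join⇒reducibleVertex : ∃ (ReducibleVertex k G)
  canonicalInterval2Join⇒reducibleVertex with lastTwo (proj₂ (proj₂ distinctPositions))
  ... | pen , last , pen+1≡last , last+1≡m with 2 ≤? ∣ Y₂ ∣
  ...   | yes 2≤∣Y₂∣ = pos last , Ends.lastReducible pen last pen+1≡last last+1≡m 2≤∣Y₂∣
  ...   | no 2≰∣Y₂∣  = pos pen , Ends.penultimateReducible pen last pen+1≡last last+1≡m (s≤s⁻¹ (≰⇒> 2≰∣Y₂∣))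

lemma4p4 : ∀ (n : ℕ) (G : Graph n) (V₂ X₁ Y₁ X₂ Y₂ : Subset n) →
             CanonicalInterval2Join G V₂ X₁ Y₁ X₂ Y₂ →
             ¬ VertexCriticalStar G
lemma4p4 n G V₂ X₁ Y₁ X₂ Y₂ cj critical =
  critical⇒¬reducibleVertex critical (canonicalInterval2Join⇒reducibleVertex cj (+-monoʳ-< (Δ₂ G) (n<1+n 2)))
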